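{- Let $G=(S,T;E)$ with $S=\{s_1,\dots,s_n\}$, $T=\{t_1,\dots,t_k\}$ and $d\in\mathbb Z_+$. Consider the algorithm $T$-Greedy: start with $M=\emptyset$ and the set of covered nodes $C=\emptyset$; for $j=1,\dots,k$: set $M_j=\emptyset$, $C_j=\emptyset$, $i=1$, and while $i\le n$, if $s_it_j\in E$ and $s_i\notin C$ then add $s_it_j$ to $M_j$, add $s_i$ to $C_j$ and set $i:=i+d$, otherwise set $i:=i+1$; afterwards set $M:=M\cup M_j$ and $C:=C\cup C_j$. Output $M$. Then the output $M$ is a $d$-distance matching with $2|M|\ge|M^*|$ for every $d$-distance matching $M^*$ of $G$; i.e., $T$-Greedy is a $2$-approximation algorithm for the maximum-cardinality $d$-distance matching problem.
   Context: $G$ is a finite bipartite graph without loops or parallel edges; the nodes of $S$ are in the fixed order $s_1,\dots,s_n$. A $d$-distance matching is a subset $M\subseteq E$ such that every node of $S$ is incident to at most one edge of $M$, and whenever $s_it,s_jt\in M$ with $i\ne j$, $t\in T$, we have $|j-i|\ge d$. -}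

module Defs where

open import Data.Nat using (ℕ; zero; suc; _+_; _≤_; _<?_; ∣_-_∣)
open import Data.Fin using (Fin; toℕ; fromℕ<)
open import Data.Fin.Properties using (_≟_)
open import Data.Bool using (Bool; true; false; if_then_else_; not; _∧_)
open import Data.List using (List; []; _∷_; _++_; map; allFin)
open import Data.List.Membership.Propositional using (_∈_)
open import Data.List.Membership.DecPropositional using () renaming (_∈?_ to _∈?ᴰ_)
open import Data.List.Relation.Unary.All using (All)
open import Data.List.Relation.Unary.Unique.Propositional using (Unique)
open import Data.Product using (_×_; _,_; proj₁; proj₂)
open import Relation.Binary.PropositionalEquality using (_≡_; _≢_)
open import Relation.Nullary using (does; yes; no)

_∈F?_ : ∀ {n} (s : Fin n) (C : List (Fin n)) → _
_∈F?_ {n} s C = _∈?ᴰ_ (_≟_ {n}) s C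

-- A bipartite graph G = (S,T;E) with S = {s_0,...,s_{n-1}} (in this order)
-- and T = {t_0,...,t_{k-1}} is given by its adjacency relation
-- E : Fin n → Fin k → Bool  (E s t = true  iff  st is an edge).
Graph : ℕ → ℕ → Set
Graph n k = Fin n → Fin k → Bool

Edge : ℕ → ℕ → Set
Edge n k = Fin n × Fin k

-- A set of edges M ⊆ E is represented by a duplicate-free list of edges;
-- its cardinality |M| is the length of the list.
IsEdgeSet : ∀ {n k} → Graph n k → List (Edge n k) → Set
IsEdgeSet G M = Unique M × All (λ e → G (proj₁ e) (proj₂ e) ≡ true) M

IsDDistanceMatching : ∀ {n k} → ℕ → Graph n k → List (Edge n k) → Set
IsDDistanceMatching {n} {k} d G M =
  IsEdgeSet G M
  × (∀ (s : Fin n) (t t′ : Fin k) → (s , t) ∈ M → (s , t′) ∈ M → t ≡ t′)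
  × (∀ (s s′ : Fin n) (t : Fin k) → (s , t) ∈ M → (s′ , t) ∈ M → s ≢ s′
       → d ≤ ∣ toℕ s′ - toℕ s ∣)

-- The algorithm T-Greedy (0-based indices).
-- Inner while-loop for a fixed t_j: i runs from 0; if i < n, s_i t_j ∈ E and
-- s_i ∉ C then s_i is taken and i := i + d, otherwise i := i + 1.
-- The first argument is fuel; fuel n suffices since d ≥ 1 makes i increase.
scanRow : ∀ {n k} → Graph n k → ℕ → List (Fin n) → Fin k → ℕ → ℕ → List (Fin n)
scanRow G d C t zero i = []
scanRow {n} G d C t (suc fuel) i with i <? n
... | no _ = []
... | yes p =
  if G (fromℕ< p) t ∧ not (does (fromℕ< p ∈F? C))
  then fromℕ< p ∷ scanRow G d C t fuel (i + d)
  else scanRow G d C t fuel (suc i)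

greedyLoop : ∀ {n k} → Graph n k → ℕ → List (Fin k)
           → List (Edge n k) × List (Fin n) → List (Edge n k) × List (Fin n)
greedyLoop G d [] acc = acc
greedyLoop {n} G d (t ∷ ts) (M , C) =
  let Cj = scanRow G d C t n 0
      Mj = map (λ s → (s , t)) Cj
  in greedyLoop G d ts (M ++ Mj , C ++ Cj)

TGreedy : ∀ {n k} → Graph n k → ℕ → List (Edge n k)
TGreedy {n} {k} G d = proj₁ (greedyLoop G d (allFin k) ([] , []))

-- Call an edge s t of G dominated by an edge set M if s is covered by M, or if
-- some s′ t ∈ M has s′ < s < s′ + d. The T-Greedy output M dominates every edge
-- of G: when row t is scanned, an uncovered neighbour s of t is either taken or
-- skipped because it lies within distance d after a node s′ just taken for t.
-- Charging each edge s t of a d-distance matching M* to the edge of M at s in the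
-- first case, and to s′ t in the second, uses every edge of M at most once per
-- case: M* has one edge at s, and at most one edge at t in the window (s′, s′ + d).
-- Hence |M*| ≤ 2|M|. That M is itself a d-distance matching holds because the
-- nodes taken in one row are d apart and covered nodes are never taken again.
module Submission where

open import Defs
open import Data.Nat using (ℕ; zero; suc; _+_; _*_; _≤_; _<_; _<?_; ∣_-_∣; z≤n; s≤s)
open import Data.Nat.Properties
  using (≤-refl; ≤-trans; ≤⇒≯; ≤-reflexive; <⇒≤; <⇒≢; <-irrefl; ≤-<-trans; <-≤-trans;
         ≤∧≢⇒<; ≮⇒≥; +-suc; +-identityʳ; +-monoʳ-≤; +-monoˡ-≤; m≤m+n; n≤1+n; m<m+n;
         ∣-∣-comm; ∣-∣-identityʳ)
open import Data.Fin using (Fin; toℕ; fromℕ<)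
open import Data.Fin.Properties using (toℕ-fromℕ<; toℕ<n; toℕ-injective; injective⇒≤)
  renaming (_≟_ to _≟ᶠ_)
open import Data.Bool using (true; false)
open import Data.Bool.Properties using (not-¬)
open import Data.List using (List; []; _∷_; _++_; map; allFin; length; lookup)
open import Data.List.Properties using (map-++; map-∘; map-id; length-++; length-map)
open import Data.List.Membership.Propositional using (_∈_; _∉_)
open import Data.List.Membership.Propositional.Properties
  using (∈-map⁺; ∈-map⁻; ∈-++⁺ˡ; ∈-++⁺ʳ; ∈-++⁻; ∈-lookup; ∈-allFin)
open import Data.List.Relation.Unary.Any using (here; there; index)
open import Data.List.Relation.Unary.Any.Properties using (lookup-index)
open import Data.List.Relation.Unary.All using (All; []; _∷_)
import Data.List.Relation.Unary.All as All
import Data.List.Relation.Unary.All.Properties as All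
open import Data.List.Relation.Unary.AllPairs using (AllPairs; []; _∷_)
import Data.List.Relation.Unary.AllPairs as AllPairs
open import Data.List.Relation.Unary.Unique.Propositional using (Unique)
import Data.List.Relation.Unary.Unique.Propositional.Properties as Unique
open import Data.Product using (_×_; _,_; proj₁; proj₂; uncurry; ∃-syntax)
open import Data.Sum using (_⊎_; inj₁; inj₂)
open import Data.Empty using (⊥-elim)
open import Relation.Binary.PropositionalEquality
  using (_≡_; _≢_; refl; sym; trans; cong; cong₂; subst; module ≡-Reasoning)
open import Relation.Nullary using (yes; no)

module _ {A : Set} where

  Unique⇒lookup-injective : ∀ {xs : List A} → Unique xs →
                            ∀ {i j} → lookup xs i ≡ lookup xs j → i ≡ j
  Unique⇒lookup-injective (_ ∷ _)   {Fin.zero}  {Fin.zero}  _  = refl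
  Unique⇒lookup-injective (x∉ ∷ _)  {Fin.zero}  {Fin.suc j} eq = ⊥-elim (All.lookup x∉ (∈-lookup j) eq)
  Unique⇒lookup-injective (x∉ ∷ _)  {Fin.suc i} {Fin.zero}  eq = ⊥-elim (All.lookup x∉ (∈-lookup i) (sym eq))
  Unique⇒lookup-injective (_ ∷ u)   {Fin.suc i} {Fin.suc j} eq = cong Fin.suc (Unique⇒lookup-injective u eq)

  length-≤-by-injective-charge :
    ∀ {B : Set} (Charged : A → B → Set) {xs : List A} {ys : List B} → Unique xs →
    (∀ {x} → x ∈ xs → ∃[ y ] y ∈ ys × Charged x y) →
    (∀ {x x′ y} → x ∈ xs → x′ ∈ xs → Charged x y → Charged x′ y → x ≡ x′) →
    length xs ≤ length ys
  length-≤-by-injective-charge Charged {xs} {ys} unique charge charged-injective =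
    injective⇒≤ chargeIndex-injective
    where
    chargeIndex : Fin (length xs) → Fin (length ys)
    chargeIndex i = index (proj₁ (proj₂ (charge (∈-lookup i))))

    chargeIndex-injective : ∀ {i j} → chargeIndex i ≡ chargeIndex j → i ≡ j
    chargeIndex-injective {i} {j} eq =
      Unique⇒lookup-injective unique
        (charged-injective (∈-lookup i) (∈-lookup j) (proj₂ (proj₂ cᵢ))
          (subst (Charged (lookup xs j)) (sym same-charge) (proj₂ (proj₂ cⱼ))))
      where
      cᵢ : ∃[ y ] y ∈ ys × Charged (lookup xs i) y
      cᵢ = charge (∈-lookup i)
      cⱼ : ∃[ y ] y ∈ ys × Charged (lookup xs j) y
      cⱼ = charge (∈-lookup j)
      same-charge : proj₁ cᵢ ≡ proj₁ cⱼ
      same-charge = trans (lookup-index (proj₁ (proj₂ cᵢ)))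
                      (trans (cong (lookup ys) eq) (sym (lookup-index (proj₁ (proj₂ cⱼ)))))

  AllPairs-related : ∀ {R : A → A → Set} {xs : List A} {x y : A} → AllPairs R xs →
                     x ∈ xs → y ∈ xs → x ≢ y → R x y ⊎ R y x
  AllPairs-related (_ ∷ _)  (here refl) (here refl) x≢y = ⊥-elim (x≢y refl)
  AllPairs-related (Rx ∷ _) (here refl) (there y∈)  _   = inj₁ (All.lookup Rx y∈)
  AllPairs-related (Rx ∷ _) (there x∈)  (here refl) _   = inj₂ (All.lookup Rx x∈)
  AllPairs-related (_ ∷ R)  (there x∈)  (there y∈)  x≢y = AllPairs-related R x∈ y∈ x≢y

m+d≤n⇒d≤∣n-m∣ : ∀ d m n → m + d ≤ n → d ≤ ∣ n - m ∣
m+d≤n⇒d≤∣n-m∣ d zero    n       h       rewrite ∣-∣-identityʳ n = h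
m+d≤n⇒d≤∣n-m∣ d (suc m) (suc n) (s≤s h) = m+d≤n⇒d≤∣n-m∣ d m n h

∣m-n∣<d : ∀ d m n → m < n + d → n < m + d → ∣ m - n ∣ < d
∣m-n∣<d d zero    zero    h _ = h
∣m-n∣<d d zero    (suc n) _ h = h
∣m-n∣<d d (suc m) zero    h _ = h
∣m-n∣<d d (suc m) (suc n) (s≤s h) (s≤s h′) = ∣m-n∣<d d m n h h′

-- Taking s′ in the scan of a row moves the scan to s′ + d, so s′ blocks every s with
-- Shadows d s′ s from that row.
Shadows : ∀ {n} → ℕ → Fin n → Fin n → Set
Shadows d s′ s = toℕ s′ < toℕ s × toℕ s < toℕ s′ + d

shadowed-close : ∀ {n} d {s′ a b : Fin n} → Shadows d s′ a → Shadows d s′ b →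
                 ∣ toℕ a - toℕ b ∣ < d
shadowed-close d (s′<a , a<s′+d) (s′<b , b<s′+d) =
  ∣m-n∣<d d _ _ (<-≤-trans a<s′+d (+-monoˡ-≤ d (<⇒≤ s′<b)))
                (<-≤-trans b<s′+d (+-monoˡ-≤ d (<⇒≤ s′<a)))

fuel-step : ∀ {n} fuel i → n ≤ suc fuel + i → n ≤ fuel + suc i
fuel-step fuel i n≤ = ≤-trans n≤ (≤-reflexive (sym (+-suc fuel i)))

fuel-jump : ∀ {n d} → 1 ≤ d → ∀ fuel i → n ≤ suc fuel + i → n ≤ fuel + (i + d)
fuel-jump d≥1 fuel i n≤ = ≤-trans (fuel-step fuel i n≤) (+-monoʳ-≤ fuel (m<m+n i d≥1))

module Scan {n k} (G : Graph n k) (d : ℕ) (C : List (Fin n)) (t : Fin k) where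

  Eligible : ℕ → Fin n → Set
  Eligible i s = G s t ≡ true × s ∉ C × i ≤ toℕ s

  Eligible-anti : ∀ {i j s} → i ≤ j → Eligible j s → Eligible i s
  Eligible-anti i≤j (edge , s∉C , j≤s) = edge , s∉C , ≤-trans i≤j j≤s

  scanRow-eligible : ∀ fuel i → All (Eligible i) (scanRow G d C t fuel i)
  scanRow-eligible zero       i = []
  scanRow-eligible (suc fuel) i with i <? n
  ... | no _    = []
  -- Generalising fromℕ< i<n to x replaces the scan position i by toℕ x everywhere.
  ... | yes i<n with fromℕ< i<n | toℕ-fromℕ< i<n
  ... | x | refl with G x t in edge | x ∈F? C
  ... | true  | no x∉C = (edge , x∉C , ≤-refl)
                         ∷ All.map (Eligible-anti (m≤m+n (toℕ x) d)) (scanRow-eligible fuel (toℕ x + d))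
  ... | true  | yes _  = All.map (Eligible-anti (n≤1+n (toℕ x))) (scanRow-eligible fuel (suc (toℕ x)))
  ... | false | _      = All.map (Eligible-anti (n≤1+n (toℕ x))) (scanRow-eligible fuel (suc (toℕ x)))

  scanRow-spaced : ∀ fuel i → AllPairs (λ a b → toℕ a + d ≤ toℕ b) (scanRow G d C t fuel i)
  scanRow-spaced zero       i = []
  scanRow-spaced (suc fuel) i with i <? n
  ... | no _    = []
  ... | yes i<n with fromℕ< i<n | toℕ-fromℕ< i<n
  ... | x | refl with G x t | x ∈F? C
  ... | true  | no _  = All.map (λ e → proj₂ (proj₂ e)) (scanRow-eligible fuel (toℕ x + d))
                        ∷ scanRow-spaced fuel (toℕ x + d)
  ... | true  | yes _ = scanRow-spaced fuel (suc (toℕ x))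
  ... | false | _     = scanRow-spaced fuel (suc (toℕ x))

  scanRow-unique : 1 ≤ d → ∀ fuel i → Unique (scanRow G d C t fuel i)
  scanRow-unique d≥1 fuel i =
    AllPairs.map (λ {a} a+d≤b a≡b → <⇒≢ (<-≤-trans (m<m+n (toℕ a) d≥1) a+d≤b) (cong toℕ a≡b))
                 (scanRow-spaced fuel i)

  scanRow-distance : ∀ fuel i {s s′} → s ∈ scanRow G d C t fuel i → s′ ∈ scanRow G d C t fuel i →
                     s ≢ s′ → d ≤ ∣ toℕ s′ - toℕ s ∣
  scanRow-distance fuel i {s} {s′} s∈ s′∈ s≢s′ with AllPairs-related (scanRow-spaced fuel i) s∈ s′∈ s≢s′
  ... | inj₁ s+d≤s′ = m+d≤n⇒d≤∣n-m∣ d _ _ s+d≤s′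
  ... | inj₂ s′+d≤s = subst (d ≤_) (∣-∣-comm (toℕ s) (toℕ s′)) (m+d≤n⇒d≤∣n-m∣ d _ _ s′+d≤s)

  RowDominated : List (Fin n) → Fin n → Set
  RowDominated L s = s ∈ L ⊎ ∃[ s′ ] s′ ∈ L × Shadows d s′ s

  RowDominated-∷ : ∀ {x L s} → RowDominated L s → RowDominated (x ∷ L) s
  RowDominated-∷ (inj₁ s∈L)              = inj₁ (there s∈L)
  RowDominated-∷ (inj₂ (s′ , s′∈L , sh)) = inj₂ (s′ , there s′∈L , sh)

  Eligible-next : ∀ {x s} → x ≢ s → Eligible (toℕ x) s → Eligible (suc (toℕ x)) s
  Eligible-next x≢s (edge , s∉C , x≤s) = edge , s∉C , ≤∧≢⇒< x≤s (λ x≡s → x≢s (toℕ-injective x≡s))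

  scanRow-complete : 1 ≤ d → ∀ fuel i → n ≤ fuel + i →
                     ∀ {s} → Eligible i s → RowDominated (scanRow G d C t fuel i) s
  scanRow-complete _ zero i n≤i {s} (_ , _ , i≤s) =
    ⊥-elim (<-irrefl refl (<-≤-trans (toℕ<n s) (≤-trans n≤i i≤s)))
  scanRow-complete d≥1 (suc fuel) i n≤ {s} el@(edge , s∉C , i≤s) with i <? n
  ... | no i≮n  = ⊥-elim (i≮n (≤-<-trans i≤s (toℕ<n s)))
  ... | yes i<n with fromℕ< i<n | toℕ-fromℕ< i<n
  ... | x | refl with G x t in x-edge | x ∈F? C | x ≟ᶠ s
  ... | true  | no _    | yes refl = inj₁ (here refl)
  ... | true  | yes x∈C | yes refl = ⊥-elim (s∉C x∈C)
  ... | false | _       | yes refl = ⊥-elim (not-¬ edge x-edge)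
  ... | true  | no _    | no x≢s with toℕ s <? toℕ x + d
  ...   | yes s<x+d = inj₂ (x , here refl , proj₂ (proj₂ (Eligible-next x≢s el)) , s<x+d)
  ...   | no s≮x+d  = RowDominated-∷ (scanRow-complete d≥1 fuel (toℕ x + d)
                        (fuel-jump d≥1 fuel (toℕ x) n≤) (edge , s∉C , ≮⇒≥ s≮x+d))
  scanRow-complete d≥1 (suc fuel) _ n≤ el | yes _ | x | refl | true | yes _ | no x≢s =
    scanRow-complete d≥1 fuel (suc (toℕ x)) (fuel-step fuel (toℕ x) n≤) (Eligible-next x≢s el)
  scanRow-complete d≥1 (suc fuel) _ n≤ el | yes _ | x | refl | false | _ | no x≢s =
    scanRow-complete d≥1 fuel (suc (toℕ x)) (fuel-step fuel (toℕ x) n≤) (Eligible-next x≢s el)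

rowEdges : ∀ {n k} → List (Fin n) → Fin k → List (Edge n k)
rowEdges L t = map (λ s → (s , t)) L

∈-rowEdges⁻ : ∀ {n k} {L : List (Fin n)} {t t′ : Fin k} {s} → (s , t′) ∈ rowEdges L t → s ∈ L × t′ ≡ t
∈-rowEdges⁻ p with ∈-map⁻ _ p
... | _ , s∈L , refl = s∈L , refl

proj₁-rowEdges : ∀ {n k} (L : List (Fin n)) (t : Fin k) → map proj₁ (rowEdges L t) ≡ L
proj₁-rowEdges L t = trans (sym (map-∘ L)) (map-id L)

Matched : ∀ {n k} → List (Edge n k) → Fin n → Set
Matched M s = ∃[ t ] (s , t) ∈ M

∈-map-proj₁⁻ : ∀ {n k} {M : List (Edge n k)} {s} → s ∈ map proj₁ M → Matched M s
∈-map-proj₁⁻ s∈ with ∈-map⁻ proj₁ s∈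
... | (_ , t) , st∈M , refl = t , st∈M

Unique-proj₁⇒functional : ∀ {n k} {M : List (Edge n k)} {s t t′} → Unique (map proj₁ M) →
                          (s , t) ∈ M → (s , t′) ∈ M → t ≡ t′
Unique-proj₁⇒functional _         (here refl) (here refl) = refl
Unique-proj₁⇒functional (s∉ ∷ _) (here refl) (there p)   = ⊥-elim (All.lookup s∉ (∈-map⁺ proj₁ p) refl)
Unique-proj₁⇒functional (s∉ ∷ _) (there p)   (here refl) = ⊥-elim (All.lookup s∉ (∈-map⁺ proj₁ p) refl)
Unique-proj₁⇒functional (_ ∷ u)  (there p)   (there q)   = Unique-proj₁⇒functional u p q

Dominated : ∀ {n k} → ℕ → List (Edge n k) → Edge n k → Set
Dominated d M (s , t) = Matched M s ⊎ ∃[ s′ ] (s′ , t) ∈ M × Shadows d s′ s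

Dominated-++ˡ : ∀ {n k d} {M : List (Edge n k)} M′ {e} → Dominated d M e → Dominated d (M ++ M′) e
Dominated-++ˡ _ (inj₁ (t , st∈M))        = inj₁ (t , ∈-++⁺ˡ st∈M)
Dominated-++ˡ _ (inj₂ (s′ , s′t∈M , sh)) = inj₂ (s′ , ∈-++⁺ˡ s′t∈M , sh)

Charged : ∀ {n k} → ℕ → Edge n k → Edge n k ⊎ Edge n k → Set
Charged d (s , _) (inj₁ (s′ , _))  = s ≡ s′
Charged d (s , t) (inj₂ (s′ , t′)) = t ≡ t′ × Shadows d s′ s

dominating⇒2-approximation :
  ∀ {n k} {G : Graph n k} {d} {M M* : List (Edge n k)} →
  (∀ {s t} → G s t ≡ true → Dominated d M (s , t)) →
  IsDDistanceMatching d G M* → length M* ≤ 2 * length M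
dominating⇒2-approximation {d = d} {M} {M*} dominates ((M*-unique , M*-edges) , M*-one , M*-spaced) =
  ≤-trans (length-≤-by-injective-charge (Charged d) M*-unique charge charge-injective)
          (≤-reflexive length-tagged)
  where
  open ≡-Reasoning

  tagged : List (Edge _ _ ⊎ Edge _ _)
  tagged = map inj₁ M ++ map inj₂ M

  length-tagged : length tagged ≡ 2 * length M
  length-tagged = begin
    length (map inj₁ M ++ map inj₂ M)          ≡⟨ length-++ (map inj₁ M) ⟩
    length (map inj₁ M) + length (map inj₂ M)  ≡⟨ cong₂ _+_ (length-map inj₁ M) (length-map inj₂ M) ⟩
    length M + length M                        ≡⟨ cong (length M +_) (sym (+-identityʳ (length M))) ⟩
    2 * length M                               ∎

  charge : ∀ {e} → e ∈ M* → ∃[ c ] c ∈ tagged × Charged d e c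
  charge {s , t} e∈M* with dominates (All.lookup M*-edges e∈M*)
  ... | inj₁ (t′ , st′∈M)      = inj₁ (s , t′) , ∈-++⁺ˡ (∈-map⁺ inj₁ st′∈M) , refl
  ... | inj₂ (s′ , s′t∈M , sh) =
    inj₂ (s′ , t) , ∈-++⁺ʳ (map inj₁ M) (∈-map⁺ inj₂ s′t∈M) , refl , sh

  charge-injective : ∀ {e e′ c} → e ∈ M* → e′ ∈ M* → Charged d e c → Charged d e′ c → e ≡ e′
  charge-injective {s , t} {_ , t′} {inj₁ _} e∈ e′∈ refl refl with M*-one s t t′ e∈ e′∈
  ... | refl = refl
  charge-injective {s₁ , t} {s₂ , _} {inj₂ _} e∈ e′∈ (refl , sh₁) (refl , sh₂) with s₁ ≟ᶠ s₂
  ... | yes refl  = refl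
  ... | no s₁≢s₂ = ⊥-elim (≤⇒≯ (M*-spaced s₁ s₂ t e∈ e′∈ s₁≢s₂) (shadowed-close d sh₂ sh₁))

module Greedy {n k} (G : Graph n k) (d : ℕ) (d≥1 : 1 ≤ d) where

  record Invariant (ts : List (Fin k)) (M : List (Edge n k)) (C : List (Fin n)) : Set where
    field
      covered≡matched : C ≡ map proj₁ M
      covered-unique  : Unique C
      edges           : All (λ e → G (proj₁ e) (proj₂ e) ≡ true) M
      spaced          : ∀ s s′ t → (s , t) ∈ M → (s′ , t) ∈ M → s ≢ s′ → d ≤ ∣ toℕ s′ - toℕ s ∣
      unscanned-free  : ∀ {s t} → (s , t) ∈ M → t ∉ ts
      dominates       : ∀ {s t} → G s t ≡ true → t ∈ ts ⊎ Dominated d M (s , t)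

  invariant-step : ∀ {t ts M C} → t ∉ ts → Invariant (t ∷ ts) M C →
                   Invariant ts (M ++ rowEdges (scanRow G d C t n 0) t) (C ++ scanRow G d C t n 0)
  invariant-step {t} {ts} {M} {C} t∉ts I = record
    { covered≡matched = covered≡matched′
    ; covered-unique  = Unique.++⁺ covered-unique (scanRow-unique d≥1 n 0)
                          (λ (s∈C , s∈Cₜ) → proj₁ (proj₂ (All.lookup eligible s∈Cₜ)) s∈C)
    ; edges           = All.++⁺ edges (All.map⁺ (All.map proj₁ eligible))
    ; spaced          = spaced′
    ; unscanned-free  = unscanned-free′
    ; dominates       = dominates′
    }
    where
    open Invariant I
    open Scan G d C t

    Cₜ : List (Fin n)
    Cₜ = scanRow G d C t n 0

    Mₜ : List (Edge n k)
    Mₜ = rowEdges Cₜ t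

    eligible : All (Eligible 0) Cₜ
    eligible = scanRow-eligible n 0

    covered≡matched′ : C ++ Cₜ ≡ map proj₁ (M ++ Mₜ)
    covered≡matched′ = begin
      C ++ Cₜ                      ≡⟨ cong₂ _++_ covered≡matched (sym (proj₁-rowEdges Cₜ t)) ⟩
      map proj₁ M ++ map proj₁ Mₜ  ≡⟨ sym (map-++ proj₁ M Mₜ) ⟩
      map proj₁ (M ++ Mₜ)          ∎
      where open ≡-Reasoning

    spaced′ : ∀ s s′ u → (s , u) ∈ M ++ Mₜ → (s′ , u) ∈ M ++ Mₜ → s ≢ s′ → d ≤ ∣ toℕ s′ - toℕ s ∣
    spaced′ s s′ u p q s≢s′ with ∈-++⁻ M p | ∈-++⁻ M q
    ... | inj₁ p∈M | inj₁ q∈M = spaced s s′ u p∈M q∈M s≢s′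
    ... | inj₁ p∈M | inj₂ q∈Mₜ with ∈-rowEdges⁻ q∈Mₜ
    ...   | _ , refl = ⊥-elim (unscanned-free p∈M (here refl))
    spaced′ s s′ u p q s≢s′ | inj₂ p∈Mₜ | inj₁ q∈M with ∈-rowEdges⁻ p∈Mₜ
    ...   | _ , refl = ⊥-elim (unscanned-free q∈M (here refl))
    spaced′ s s′ u p q s≢s′ | inj₂ p∈Mₜ | inj₂ q∈Mₜ =
      scanRow-distance n 0 (proj₁ (∈-rowEdges⁻ p∈Mₜ)) (proj₁ (∈-rowEdges⁻ q∈Mₜ)) s≢s′

    unscanned-free′ : ∀ {s u} → (s , u) ∈ M ++ Mₜ → u ∉ ts
    unscanned-free′ p u∈ts with ∈-++⁻ M p
    ... | inj₁ p∈M = unscanned-free p∈M (there u∈ts)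
    ... | inj₂ p∈Mₜ with ∈-rowEdges⁻ p∈Mₜ
    ...   | _ , refl = t∉ts u∈ts

    dominates′ : ∀ {s u} → G s u ≡ true → u ∈ ts ⊎ Dominated d (M ++ Mₜ) (s , u)
    dominates′ {s} edge with dominates edge
    ... | inj₂ dom          = inj₂ (Dominated-++ˡ Mₜ dom)
    ... | inj₁ (there u∈ts) = inj₁ u∈ts
    ... | inj₁ (here refl) with s ∈F? C
    ...   | yes s∈C = inj₂ (Dominated-++ˡ Mₜ (inj₁ (∈-map-proj₁⁻ (subst (s ∈_) covered≡matched s∈C))))
    ...   | no s∉C with scanRow-complete d≥1 n 0 (≤-reflexive (sym (+-identityʳ n))) (edge , s∉C , z≤n)
    ...     | inj₁ s∈Cₜ              = inj₂ (inj₁ (t , ∈-++⁺ʳ M (∈-map⁺ _ s∈Cₜ)))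
    ...     | inj₂ (s′ , s′∈Cₜ , sh) = inj₂ (inj₂ (s′ , ∈-++⁺ʳ M (∈-map⁺ _ s′∈Cₜ) , sh))

  invariant-loop : ∀ ts {M C} → Unique ts → Invariant ts M C →
                   uncurry (Invariant []) (greedyLoop G d ts (M , C))
  invariant-loop []       _            I = I
  invariant-loop (t ∷ ts) (t∉ts ∷ uts) I =
    invariant-loop ts uts (invariant-step (λ t∈ts → All.lookup t∉ts t∈ts refl) I)

  invariant-initial : Invariant (allFin k) [] []
  invariant-initial = record
    { covered≡matched = refl
    ; covered-unique  = []
    ; edges           = []
    ; spaced          = λ _ _ _ ()
    ; unscanned-free  = λ ()
    ; dominates       = λ {_} {t} _ → inj₁ (∈-allFin t)
    }

  greedy-invariant : uncurry (Invariant []) (greedyLoop G d (allFin k) ([] , []))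
  greedy-invariant = invariant-loop (allFin k) (Unique.allFin⁺ k) invariant-initial

  open Invariant greedy-invariant

  TGreedy-isDDistanceMatching : IsDDistanceMatching d G (TGreedy G d)
  TGreedy-isDDistanceMatching =
    (Unique.map⁻ matched-unique , edges) ,
    (λ _ _ _ → Unique-proj₁⇒functional matched-unique) ,
    spaced
    where
    matched-unique : Unique (map proj₁ (TGreedy G d))
    matched-unique = subst Unique covered≡matched covered-unique

  TGreedy-dominates : ∀ {s t} → G s t ≡ true → Dominated d (TGreedy G d) (s , t)
  TGreedy-dominates edge with dominates edge
  ... | inj₂ dom = dom

theorem9 : ∀ {n k} (G : Graph n k) (d : ℕ) → 1 ≤ d
    → IsDDistanceMatching d G (TGreedy G d)
      × (∀ (M* : List (Edge n k)) → IsDDistanceMatching d G M*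
           → length M* ≤ 2 * length (TGreedy G d))
theorem9 G d d≥1 =
  TGreedy-isDDistanceMatching ,
  λ _ M*-matching → dominating⇒2-approximation TGreedy-dominates M*-matching
  where open Greedy G d d≥1
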